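{- For every positive integer $n$, \[ \sum_{k=0}^{n-1}L_{k-1}\,\mathbb{F}_{k}=L_{n}\,\mathbb{F}_{n}-\sum_{k=0}^{n-1}\frac{L_{k+1}}{F_{k+1}}. \]
   Context: $F_n$ denotes the Fibonacci numbers: $F_0=0$, $F_1=1$, $F_{n+2}=F_{n+1}+F_n$. $L_n$ denotes the Lucas numbers: $L_0=2$, $L_1=1$, $L_{n+2}=L_{n+1}+L_n$, extended backwards by the same recurrence so that $L_{ -1}=-1$. The $n$-th harmonic Fibonacci number is $\mathbb{F}_{n}=\sum_{k=1}^{n}\frac{1}{F_{k}}$ for $n\ge 1$, with $\mathbb{F}_0=0$. -}

module Defs where

open import Data.Nat as ℕ using (ℕ; zero; suc; NonZero)
open import Data.Nat.Properties using (≤-trans; m≤m+n)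
open import Data.Integer as ℤ using (ℤ; +_; -[1+_])
open import Data.Rational as ℚ using (ℚ; 0ℚ; _+_; _*_; _-_; _/_)

fib : ℕ → ℕ
fib 0 = 0
fib 1 = 1
fib (suc (suc n)) = fib (suc n) ℕ.+ fib n

lucasℕ : ℕ → ℕ
lucasℕ 0 = 2
lucasℕ 1 = 1
lucasℕ (suc (suc n)) = lucasℕ (suc n) ℕ.+ lucasℕ n

-- Lucas numbers on all integer indices (extended backwards by the
-- recurrence, which gives L_{-m} = (-1)^m L_m; in particular L_{-1} = -1)
sign : ℕ → ℤ
sign 0 = + 1
sign (suc m) = ℤ.- sign m

lucas : ℤ → ℤ
lucas (+ n) = + lucasℕ n
lucas -[1+ m ] = sign (suc m) ℤ.* (+ lucasℕ (suc m))

fib-suc-pos : ∀ k → 1 ℕ.≤ fib (suc k)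
fib-suc-pos zero = ℕ.s≤s ℕ.z≤n
fib-suc-pos (suc k) = ≤-trans (fib-suc-pos k) (m≤m+n (fib (suc k)) (fib k))

invFibSuc : ℕ → ℚ
invFibSuc k = _/_ (+ 1) (fib (suc k)) {{ℕ.>-nonZero (fib-suc-pos k)}}

sumℚ : ℕ → (ℕ → ℚ) → ℚ
sumℚ zero f = 0ℚ
sumℚ (suc n) f = sumℚ n f + f n

-- harmonic Fibonacci number 𝔽_n = Σ_{k=1}^{n} 1 / F_k, 𝔽_0 = 0
harmFib : ℕ → ℚ
harmFib n = sumℚ n invFibSuc

toℚ : ℤ → ℚ
toℚ z = z / 1

{-# OPTIONS --safe #-}
-- Abel summation: since L_{k-1} = L_{k+1} - L_k and 𝔽 is the sequence of partial sums of
-- 1/F_{k+1}, the sum of L_{k-1} 𝔽_k telescopes into L_n 𝔽_n minus the sum of L_{k+1}/F_{k+1}.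
module Submission where

open import Defs
open import Data.Nat using (ℕ; suc; _≥_)
open import Data.Integer as ℤ using (+_)
open import Data.Rational using (ℚ; _+_; _*_; _-_; 0ℚ; mkℚ)
open import Data.Rational.Properties using (↥p/↧p≡p; _≟_; +-*-commutativeRing)
import Data.Integer.Properties as ℤ
import Data.Nat.Coprimality as Coprime
open import Relation.Nullary.Decidable using (dec⇒maybe)
open import Level using (0ℓ)
open import Tactic.RingSolver using (solve-∀)
open import Tactic.RingSolver.Core.AlmostCommutativeRing
  using (AlmostCommutativeRing; fromCommutativeRing)
open import Relation.Binary.PropositionalEquality

ℚ-ring : AlmostCommutativeRing 0ℓ 0ℓ
ℚ-ring = fromCommutativeRing +-*-commutativeRing (λ x → dec⇒maybe (0ℚ ≟ x))

toℚ≡mkℚ : ∀ i → toℚ i ≡ mkℚ i 0 (Coprime.sym (Coprime.1-coprimeTo ℤ.∣ i ∣))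
toℚ≡mkℚ i = ↥p/↧p≡p (mkℚ i 0 (Coprime.sym (Coprime.1-coprimeTo ℤ.∣ i ∣)))

-- Adding two rationals in normal form with denominator 1 computes to toℚ (i * 1 + j * 1).
toℚ-homo-+ : ∀ i j → toℚ (i ℤ.+ j) ≡ toℚ i + toℚ j
toℚ-homo-+ i j = begin
  toℚ (i ℤ.+ j)
    ≡⟨ cong₂ (λ a b → toℚ (a ℤ.+ b)) (sym (ℤ.*-identityʳ i)) (sym (ℤ.*-identityʳ j)) ⟩
  toℚ (i ℤ.* + 1 ℤ.+ j ℤ.* + 1)
    ≡⟨ cong₂ _+_ (sym (toℚ≡mkℚ i)) (sym (toℚ≡mkℚ j)) ⟩
  toℚ i + toℚ j ∎
  where open ≡-Reasoning

lucas-suc : ∀ n → toℚ (lucas (+ suc n)) ≡ toℚ (lucas (+ n)) + toℚ (lucas (+ n ℤ.- + 1))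
lucas-suc 0       = refl
lucas-suc (suc n) = toℚ-homo-+ (+ lucasℕ (suc n)) (+ lucasℕ n)

summation-by-parts : (a c d : ℕ → ℚ) → (∀ k → a (suc k) ≡ a k + c k) → ∀ n →
  sumℚ n (λ k → c k * sumℚ k d) ≡ a n * sumℚ n d - sumℚ n (λ k → a (suc k) * d k)
summation-by-parts a c d a-suc 0       = base (a 0)
  where
  base : ∀ x → 0ℚ ≡ x * 0ℚ - 0ℚ
  base = solve-∀ ℚ-ring
summation-by-parts a c d a-suc (suc n) = begin
  sumℚ n (λ k → c k * sumℚ k d) + c n * D
    ≡⟨ cong (_+ c n * D) (summation-by-parts a c d a-suc n) ⟩
  (a n * D - T) + c n * D
    ≡⟨ step (a n) (c n) D (d n) T ⟩
  (a n + c n) * (D + d n) - (T + (a n + c n) * d n)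
    ≡⟨ cong (λ x → x * (D + d n) - (T + x * d n)) (sym (a-suc n)) ⟩
  a (suc n) * (D + d n) - (T + a (suc n) * d n) ∎
  where
  open ≡-Reasoning
  D = sumℚ n d
  T = sumℚ n (λ k → a (suc k) * d k)
  step : ∀ x y s e t → (x * s - t) + y * s ≡ (x + y) * (s + e) - (t + (x + y) * e)
  step = solve-∀ ℚ-ring

mainTheorem8 : (n : ℕ) → n ≥ 1 →
    sumℚ n (λ k → toℚ (lucas (+ k ℤ.- + 1)) * harmFib k)
      ≡ toℚ (lucas (+ n)) * harmFib n
        - sumℚ n (λ k → toℚ (lucas (+ suc k)) * invFibSuc k)
mainTheorem8 n _ =
  summation-by-parts (λ k → toℚ (lucas (+ k))) (λ k → toℚ (lucas (+ k ℤ.- + 1)))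
    invFibSuc lucas-suc n
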